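{- Let $\mathcal{X}$ and $\mathcal{A}$ be concretely order-regular categories and let $F:\mathcal{X}\to\mathcal{A}$, $G:\mathcal{A}\to\mathcal{X}$ be contravariant functors forming a dual equivalence. Assume that $F$ preserves exact squares in the sense that $(Fq)^\ast\cdot(Fp)_\ast=(Fg)_\ast\cdot(Ff)^\ast$ for every exact square $p:W\to A_1$, $q:W\to A_2$, $f:A_1\to C$, $g:A_2\to C$ in $\mathcal{X}$, that $F$ maps surjections to embeddings, and that $G$ satisfies the same two conditions (with $\mathcal{A}$ in place of $\mathcal{X}$). Then $F$ and $G$ extend to an equivalence $\overline F:\mathsf{Rel}(\mathcal{X})^{\mathrm{co}}\to\mathsf{Rel}(\mathcal{A})$, $\overline G:\mathsf{Rel}(\mathcal{A})\to\mathsf{Rel}(\mathcal{X})^{\mathrm{co}}$, where for a relation $r:X\looparrowright Y$ tabulated by a span $(p:W\to X,q:W\to Y)$ one sets $(a,b)\in\overline F r$ iff $Fp(a)\le Fq(b)$ in $FW$ (and $\overline G$ analogously). Restricting this equivalence to maps gives back the dual equivalence $(F,G)$, i.e. $\overline F(f_\ast)=(Ff)^\ast$ and $\overline G(g^\ast)=(Gg)_\ast$.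
   Context: A concretely order-regular category is a locally monotone functor $U:\mathcal{C}\to\mathsf{Pos}$ (posets and monotone maps) from a poset-enriched category such that: $U$ is order-preserving and order-reflecting on homsets; $\mathcal{C}$ has, and $U$ preserves, finite $\mathsf{Pos}$-enriched (weighted) limits; $\mathcal{C}$ has a factorisation system $(\mathcal{E},\mathcal{M})$ with $U\mathcal{E}$ the surjections and $U\mathcal{M}$ the order-embeddings, and (surjection, embedding)-factorisations of $Uf$ lift uniquely. Surjections/embeddings in $\mathcal{C}$ are arrows whose $U$-image is one. A weakening relation $R:A\looparrowright B$ of posets is a subset of $A\times B$ with $a'\le aRb\le b'\Rightarrow a'Rb'$; composition $S\cdot R$ is relational composition ($R$ first), identities are orders. For $f:A\to B$: $f_\ast=\{(a,b)\mid f(a)\le b\}$, $f^\ast=\{(b,a)\mid b\le f(a)\}$. A $\mathcal{C}$-relation $A\looparrowright B$ is a weakening relation $UA\looparrowright UB$ whose graph with its projections is the $U$-image of a span in $\mathcal{C}$ (that span "tabulates" it). $\mathsf{Rel}(\mathcal{C})$: objects of $\mathcal{C}$, $\mathcal{C}$-relations as arrows, inclusion order; $^{\mathrm{co}}$ reverses the homset order. A square $p:W\to A_1,q:W\to A_2,f:A_1\to C,g:A_2\to C$ is exact if $fp\le gq$ and whenever $Uf(x)\le Ug(y)$ there is $w$ with $x\le Up(w)$ and $Uq(w)\le y$. -}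

module Defs where

open import Level using (0ℓ)
open import Relation.Binary.Bundles using (Poset)
open import Data.Product using (Σ; Σ-syntax; ∃; ∃-syntax; _×_; _,_)

Pos : Set₁
Pos = Poset 0ℓ 0ℓ 0ℓ

∣_∣ : Pos → Set
∣ P ∣ = Poset.Carrier P

infix 4 _∋_≤_ _∋_≈_

_∋_≤_ : (P : Pos) → ∣ P ∣ → ∣ P ∣ → Set
P ∋ x ≤ y = Poset._≤_ P x y

_∋_≈_ : (P : Pos) → ∣ P ∣ → ∣ P ∣ → Set
P ∋ x ≈ y = Poset._≈_ P x y

IsMonotone : (P Q : Pos) → (∣ P ∣ → ∣ Q ∣) → Set
IsMonotone P Q f = ∀ {x y} → P ∋ x ≤ y → Q ∋ f x ≤ f y

IsSurjective : (P Q : Pos) → (∣ P ∣ → ∣ Q ∣) → Set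
IsSurjective P Q f = ∀ y → ∃[ x ] (Q ∋ f x ≈ y)

-- order-embedding in Pos (for a monotone map: order-reflecting)
IsOrderEmbedding : (P Q : Pos) → (∣ P ∣ → ∣ Q ∣) → Set
IsOrderEmbedding P Q f = ∀ x y → Q ∋ f x ≤ f y → P ∋ x ≤ y

_⊆_ : {A B : Set} → (A → B → Set) → (A → B → Set) → Set
R ⊆ S = ∀ a b → R a b → S a b

_≐_ : {A B : Set} → (A → B → Set) → (A → B → Set) → Set
R ≐ S = (R ⊆ S) × (S ⊆ R)

_·_ : {A B C : Set} → (B → C → Set) → (A → B → Set) → A → C → Set
(S · R) a c = ∃[ b ] (R a b × S b c)

infix 4 _⊆_ _≐_
infixr 9 _·_

-- the order of a poset, as a (weakening) relation: identity of Rel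
ord : (P : Pos) → ∣ P ∣ → ∣ P ∣ → Set
ord P x y = P ∋ x ≤ y

IsWeakening : (P Q : Pos) → (∣ P ∣ → ∣ Q ∣ → Set) → Set
IsWeakening P Q R = ∀ {a' a b b'} → P ∋ a' ≤ a → R a b → Q ∋ b ≤ b' → R a' b'

lowerStar : {A : Set} (Q : Pos) → (A → ∣ Q ∣) → A → ∣ Q ∣ → Set
lowerStar Q f a b = Q ∋ f a ≤ b

upperStar : {A : Set} (Q : Pos) → (A → ∣ Q ∣) → ∣ Q ∣ → A → Set
upperStar Q f b a = Q ∋ b ≤ f a

-- Poset-enriched categories (homsets are posets, presented as preorders
-- with equality = mutual inequality; composition monotone)

record PosCat : Set₂ where
  infixr 9 _∘_
  infix 4 _≤_ _≈_
  field
    Obj : Set₁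
    Hom : Obj → Obj → Set
    _≤_ : ∀ {A B} → Hom A B → Hom A B → Set
    ≤-refl : ∀ {A B} {f : Hom A B} → f ≤ f
    ≤-trans : ∀ {A B} {f g h : Hom A B} → f ≤ g → g ≤ h → f ≤ h
    id : ∀ {A} → Hom A A
    _∘_ : ∀ {A B C} → Hom B C → Hom A B → Hom A C
    ∘-mono : ∀ {A B C} {g g' : Hom B C} {f f' : Hom A B} →
             g ≤ g' → f ≤ f' → g ∘ f ≤ g' ∘ f'

  _≈_ : ∀ {A B} → Hom A B → Hom A B → Set
  f ≈ g = (f ≤ g) × (g ≤ f)

  field
    identityˡ : ∀ {A B} (f : Hom A B) → id ∘ f ≈ f
    identityʳ : ∀ {A B} (f : Hom A B) → f ∘ id ≈ f
    assoc : ∀ {A B C D} (h : Hom C D) (g : Hom B C) (f : Hom A B) →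
            (h ∘ g) ∘ f ≈ h ∘ (g ∘ f)

record Concrete (C : PosCat) : Set₁ where
  open PosCat C
  field
    U₀ : Obj → Pos
    U₁ : ∀ {A B} → Hom A B → ∣ U₀ A ∣ → ∣ U₀ B ∣
    U₁-mono : ∀ {A B} (f : Hom A B) → IsMonotone (U₀ A) (U₀ B) (U₁ f)
    U-id : ∀ {A} (x : ∣ U₀ A ∣) → U₀ A ∋ U₁ (id {A}) x ≈ x
    U-∘ : ∀ {A B D} (g : Hom B D) (f : Hom A B) (x : ∣ U₀ A ∣) →
          U₀ D ∋ U₁ (g ∘ f) x ≈ U₁ g (U₁ f x)
    U-≤ : ∀ {A B} {f g : Hom A B} → f ≤ g → ∀ x → U₀ B ∋ U₁ f x ≤ U₁ g x
    U-reflect : ∀ {A B} {f g : Hom A B} →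
                (∀ x → U₀ B ∋ U₁ f x ≤ U₁ g x) → f ≤ g

module _ {C : PosCat} (U : Concrete C) where
  open PosCat C
  open Concrete U

  IsSurjectionC : ∀ {A B} → Hom A B → Set
  IsSurjectionC {A} {B} f = IsSurjective (U₀ A) (U₀ B) (U₁ f)

  IsEmbeddingC : ∀ {A B} → Hom A B → Set
  IsEmbeddingC {A} {B} f = IsOrderEmbedding (U₀ A) (U₀ B) (U₁ f)

  -- Finite Pos-weighted limits, via the generating class:
  -- terminal object, pullbacks, powers (cotensors) by the chain 2.
  -- Each is required to be a Pos-enriched limit in C (1- and 2-dimensional
  -- universal property) whose U-image is a limit in Pos.

  record Terminal : Set₁ where
    field
      ⊤ : Obj
      ! : ∀ A → Hom A ⊤
      !-unique : ∀ {A} (f g : Hom A ⊤) → f ≤ g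
      U-pt : ∣ U₀ ⊤ ∣
      U-unique : ∀ (x y : ∣ U₀ ⊤ ∣) → U₀ ⊤ ∋ x ≈ y

  record Pullback {A B Z : Obj} (f : Hom A Z) (g : Hom B Z) : Set₁ where
    field
      P : Obj
      π₁ : Hom P A
      π₂ : Hom P B
      commutes : f ∘ π₁ ≈ g ∘ π₂
      universal : ∀ {X} (h : Hom X A) (k : Hom X B) → f ∘ h ≈ g ∘ k →
                  Σ[ u ∈ Hom X P ] ((π₁ ∘ u ≈ h) × (π₂ ∘ u ≈ k))
      reflect : ∀ {X} (u v : Hom X P) → π₁ ∘ u ≤ π₁ ∘ v → π₂ ∘ u ≤ π₂ ∘ v → u ≤ v
      U-universal : ∀ (a : ∣ U₀ A ∣) (b : ∣ U₀ B ∣) → U₀ Z ∋ U₁ f a ≈ U₁ g b →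
                    Σ[ z ∈ ∣ U₀ P ∣ ] ((U₀ A ∋ U₁ π₁ z ≈ a) × (U₀ B ∋ U₁ π₂ z ≈ b))
      U-reflect : ∀ (z z' : ∣ U₀ P ∣) → U₀ A ∋ U₁ π₁ z ≤ U₁ π₁ z' →
                  U₀ B ∋ U₁ π₂ z ≤ U₁ π₂ z' → U₀ P ∋ z ≤ z'

  record Power2 (A : Obj) : Set₁ where
    field
      P : Obj
      d₀ : Hom P A
      d₁ : Hom P A
      d₀≤d₁ : d₀ ≤ d₁
      universal : ∀ {X} (h₀ h₁ : Hom X A) → h₀ ≤ h₁ →
                  Σ[ u ∈ Hom X P ] ((d₀ ∘ u ≈ h₀) × (d₁ ∘ u ≈ h₁))
      reflect : ∀ {X} (u v : Hom X P) → d₀ ∘ u ≤ d₀ ∘ v → d₁ ∘ u ≤ d₁ ∘ v → u ≤ v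
      U-universal : ∀ (a b : ∣ U₀ A ∣) → U₀ A ∋ a ≤ b →
                    Σ[ z ∈ ∣ U₀ P ∣ ] ((U₀ A ∋ U₁ d₀ z ≈ a) × (U₀ A ∋ U₁ d₁ z ≈ b))
      U-reflect : ∀ (z z' : ∣ U₀ P ∣) → U₀ A ∋ U₁ d₀ z ≤ U₁ d₀ z' →
                  U₀ A ∋ U₁ d₁ z ≤ U₁ d₁ z' → U₀ P ∋ z ≤ z'

  record IsFactorisationSystem : Set₁ where
    field
      factor : ∀ {A B} (f : Hom A B) →
               Σ[ Z ∈ Obj ] Σ[ e ∈ Hom A Z ] Σ[ m ∈ Hom Z B ]
                 (IsSurjectionC e × IsEmbeddingC m × (m ∘ e ≈ f))
      diagonal : ∀ {A B X Y} (e : Hom A B) (m : Hom X Y) (u : Hom A X) (v : Hom B Y) →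
                 IsSurjectionC e → IsEmbeddingC m → m ∘ u ≈ v ∘ e →
                 Σ[ d ∈ Hom B X ] ((d ∘ e ≈ u) × (m ∘ d ≈ v))
      diagonal-unique : ∀ {A B X Y} (e : Hom A B) (m : Hom X Y) (u : Hom A X) (v : Hom B Y)
                        (d d' : Hom B X) → IsSurjectionC e → IsEmbeddingC m →
                        d ∘ e ≈ u → m ∘ d ≈ v → d' ∘ e ≈ u → m ∘ d' ≈ v → d ≈ d'

  record FactorisationLift {A B : Obj} (f : Hom A B) (Q : Pos)
           (e' : ∣ U₀ A ∣ → ∣ Q ∣) (m' : ∣ Q ∣ → ∣ U₀ B ∣) : Set₁ where
    field
      Z : Obj
      e : Hom A Z
      m : Hom Z B
      factors : m ∘ e ≈ f
      φ : ∣ U₀ Z ∣ → ∣ Q ∣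
      ψ : ∣ Q ∣ → ∣ U₀ Z ∣
      φ-mono : IsMonotone (U₀ Z) Q φ
      ψ-mono : IsMonotone Q (U₀ Z) ψ
      ψφ : ∀ z → U₀ Z ∋ ψ (φ z) ≈ z
      φψ : ∀ q → Q ∋ φ (ψ q) ≈ q
      φ-e : ∀ x → Q ∋ φ (U₁ e x) ≈ e' x
      m-φ : ∀ z → U₀ B ∋ m' (φ z) ≈ U₁ m z

  record LiftsFactorisationsUniquely : Set₁ where
    field
      lift : ∀ {A B} (f : Hom A B) (Q : Pos) (e' : ∣ U₀ A ∣ → ∣ Q ∣) (m' : ∣ Q ∣ → ∣ U₀ B ∣) →
             IsMonotone (U₀ A) Q e' → IsMonotone Q (U₀ B) m' →
             IsSurjective (U₀ A) Q e' → IsOrderEmbedding Q (U₀ B) m' →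
             (∀ x → U₀ B ∋ m' (e' x) ≈ U₁ f x) →
             FactorisationLift f Q e' m'
      unique : ∀ {A B} (f : Hom A B) (Q : Pos) (e' : ∣ U₀ A ∣ → ∣ Q ∣) (m' : ∣ Q ∣ → ∣ U₀ B ∣)
               (L L' : FactorisationLift f Q e' m') →
               Σ[ j ∈ Hom (FactorisationLift.Z L) (FactorisationLift.Z L') ]
               Σ[ j' ∈ Hom (FactorisationLift.Z L') (FactorisationLift.Z L) ]
                 ((j' ∘ j ≈ id) × (j ∘ j' ≈ id) ×
                  (j ∘ FactorisationLift.e L ≈ FactorisationLift.e L') ×
                  (FactorisationLift.m L' ∘ j ≈ FactorisationLift.m L))

  record IsOrderRegular : Set₂ where
    field
      terminal : Terminal
      pullback : ∀ {A B Z} (f : Hom A Z) (g : Hom B Z) → Pullback f g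
      power2 : ∀ A → Power2 A
      factorisation : IsFactorisationSystem
      lifting : LiftsFactorisationsUniquely

  record Span (A B : Obj) : Set₁ where
    field
      apex : Obj
      left : Hom apex A
      right : Hom apex B

  -- the graph of R (with its projections) is the U-image of the span:
  -- <U left , U right> is an order-embedding with image exactly R
  Tabulates : ∀ {A B} → (∣ U₀ A ∣ → ∣ U₀ B ∣ → Set) → Span A B → Set
  Tabulates {A} {B} R s =
      (∀ a b → R a b →
         Σ[ w ∈ ∣ U₀ apex ∣ ] ((U₀ A ∋ U₁ left w ≈ a) × (U₀ B ∋ U₁ right w ≈ b)))
    × (∀ w → R (U₁ left w) (U₁ right w))
    × (∀ w w' → U₀ A ∋ U₁ left w ≤ U₁ left w' → U₀ B ∋ U₁ right w ≤ U₁ right w' →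
         U₀ apex ∋ w ≤ w')
    where open Span s

  IsCRel : ∀ {A B} → (∣ U₀ A ∣ → ∣ U₀ B ∣ → Set) → Set₁
  IsCRel {A} {B} R = IsWeakening (U₀ A) (U₀ B) R × Σ[ s ∈ Span A B ] Tabulates R s

  IsExactSquare : ∀ {W A₁ A₂ Z} → Hom W A₁ → Hom W A₂ → Hom A₁ Z → Hom A₂ Z → Set
  IsExactSquare {W} {A₁} {A₂} {Z} p q f g =
      (f ∘ p ≤ g ∘ q)
    × (∀ x y → U₀ Z ∋ U₁ f x ≤ U₁ g y →
         Σ[ w ∈ ∣ U₀ W ∣ ] ((U₀ A₁ ∋ x ≤ U₁ p w) × (U₀ A₂ ∋ U₁ q w ≤ y)))

record OrderRegular : Set₂ where
  field
    cat : PosCat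
    U : Concrete cat
    isOrderRegular : IsOrderRegular U

record DualFunctor (C D : PosCat) : Set₁ where
  private
    module C = PosCat C
    module D = PosCat D
  field
    F₀ : C.Obj → D.Obj
    F₁ : ∀ {A B} → C.Hom A B → D.Hom (F₀ B) (F₀ A)
    F-mono : ∀ {A B} {f g : C.Hom A B} → f C.≤ g → F₁ f D.≤ F₁ g
    F-id : ∀ {A} → F₁ (C.id {A}) D.≈ D.id
    F-∘ : ∀ {A B Z} (g : C.Hom B Z) (f : C.Hom A B) → F₁ (g C.∘ f) D.≈ F₁ f D.∘ F₁ g

record IsDualEquivalence {C D : PosCat} (F : DualFunctor C D) (G : DualFunctor D C) : Set₁ where
  private
    module C = PosCat C
    module D = PosCat D
    module F = DualFunctor F
    module G = DualFunctor G
  field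
    η : ∀ X → C.Hom X (G.F₀ (F.F₀ X))
    η⁻¹ : ∀ X → C.Hom (G.F₀ (F.F₀ X)) X
    η⁻¹η : ∀ X → η⁻¹ X C.∘ η X C.≈ C.id
    ηη⁻¹ : ∀ X → η X C.∘ η⁻¹ X C.≈ C.id
    η-natural : ∀ {X Y} (f : C.Hom X Y) → G.F₁ (F.F₁ f) C.∘ η X C.≈ η Y C.∘ f
    ε : ∀ A → D.Hom A (F.F₀ (G.F₀ A))
    ε⁻¹ : ∀ A → D.Hom (F.F₀ (G.F₀ A)) A
    ε⁻¹ε : ∀ A → ε⁻¹ A D.∘ ε A D.≈ D.id
    εε⁻¹ : ∀ A → ε A D.∘ ε⁻¹ A D.≈ D.id
    ε-natural : ∀ {A B} (g : D.Hom A B) → F.F₁ (G.F₁ g) D.∘ ε A D.≈ ε B D.∘ g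

module _ {C D : PosCat} (UC : Concrete C) (UD : Concrete D) (H : DualFunctor C D) where
  private
    module C = PosCat C
    module UC = Concrete UC
    module UD = Concrete UD
  open DualFunctor H

  PreservesExactSquares : Set₁
  PreservesExactSquares =
    ∀ {W A₁ A₂ Z} (p : C.Hom W A₁) (q : C.Hom W A₂) (f : C.Hom A₁ Z) (g : C.Hom A₂ Z) →
    IsExactSquare UC p q f g →
      (upperStar (UD.U₀ (F₀ W)) (UD.U₁ (F₁ q)) · lowerStar (UD.U₀ (F₀ W)) (UD.U₁ (F₁ p)))
      ≐ (lowerStar (UD.U₀ (F₀ A₂)) (UD.U₁ (F₁ g)) · upperStar (UD.U₀ (F₀ A₁)) (UD.U₁ (F₁ f)))

  SurjectionsToEmbeddings : Set₁
  SurjectionsToEmbeddings =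
    ∀ {A B} (e : C.Hom A B) → IsSurjectionC UC e → IsEmbeddingC UD (F₁ e)

  LiftRel : ∀ {A B} → Span UC A B → ∣ UD.U₀ (F₀ A) ∣ → ∣ UD.U₀ (F₀ B) ∣ → Set
  LiftRel s a b = UD.U₀ (F₀ apex) ∋ UD.U₁ (F₁ left) a ≤ UD.U₁ (F₁ right) b
    where open Span s

  record IsRelExtension : Set₂ where
    field
      well-defined : ∀ {A B} (R : ∣ UC.U₀ A ∣ → ∣ UC.U₀ B ∣ → Set) (s s' : Span UC A B) →
                     IsWeakening (UC.U₀ A) (UC.U₀ B) R → Tabulates UC R s → Tabulates UC R s' →
                     LiftRel s ≐ LiftRel s'
      is-relation : ∀ {A B} (R : ∣ UC.U₀ A ∣ → ∣ UC.U₀ B ∣ → Set) (s : Span UC A B) →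
                    IsWeakening (UC.U₀ A) (UC.U₀ B) R → Tabulates UC R s →
                    IsCRel UD (LiftRel s)
      preserves-id : ∀ {A} (s : Span UC A A) → Tabulates UC (ord (UC.U₀ A)) s →
                     LiftRel s ≐ ord (UD.U₀ (F₀ A))
      preserves-∘ : ∀ {A B Z} (R : ∣ UC.U₀ A ∣ → ∣ UC.U₀ B ∣ → Set)
                    (S : ∣ UC.U₀ B ∣ → ∣ UC.U₀ Z ∣ → Set)
                    (s : Span UC A B) (t : Span UC B Z) (u : Span UC A Z) →
                    IsWeakening (UC.U₀ A) (UC.U₀ B) R → IsWeakening (UC.U₀ B) (UC.U₀ Z) S →
                    Tabulates UC R s → Tabulates UC S t → Tabulates UC (S · R) u →
                    LiftRel u ≐ (LiftRel t · LiftRel s)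
      -- locally monotone out of Rel(C)^co : R ⊆ R' ⇒ H̄ R' ⊆ H̄ R
      antitone : ∀ {A B} (R R' : ∣ UC.U₀ A ∣ → ∣ UC.U₀ B ∣ → Set) (s s' : Span UC A B) →
                 IsWeakening (UC.U₀ A) (UC.U₀ B) R → IsWeakening (UC.U₀ A) (UC.U₀ B) R' →
                 Tabulates UC R s → Tabulates UC R' s' → R ⊆ R' →
                 LiftRel s' ⊆ LiftRel s

module _ {X A : PosCat} (UX : Concrete X) (UA : Concrete A)
         (F : DualFunctor X A) (G : DualFunctor A X) where
  private
    module X = PosCat X
    module A = PosCat A
    module UX = Concrete UX
    module UA = Concrete UA
    module F = DualFunctor F
    module G = DualFunctor G

  record RelExtensionEquivalence : Set₂ where
    field
      F̄ : IsRelExtension UX UA F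
      Ḡ : IsRelExtension UA UX G
      θ : ∀ Y → ∣ UX.U₀ Y ∣ → ∣ UX.U₀ (G.F₀ (F.F₀ Y)) ∣ → Set
      θ⁻¹ : ∀ Y → ∣ UX.U₀ (G.F₀ (F.F₀ Y)) ∣ → ∣ UX.U₀ Y ∣ → Set
      θ-rel : ∀ Y → IsCRel UX (θ Y)
      θ⁻¹-rel : ∀ Y → IsCRel UX (θ⁻¹ Y)
      θ⁻¹θ : ∀ Y → (θ⁻¹ Y · θ Y) ≐ ord (UX.U₀ Y)
      θθ⁻¹ : ∀ Y → (θ Y · θ⁻¹ Y) ≐ ord (UX.U₀ (G.F₀ (F.F₀ Y)))
      θ-natural : ∀ {Y Y'} (R : ∣ UX.U₀ Y ∣ → ∣ UX.U₀ Y' ∣ → Set)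
                  (s : Span UX Y Y') (t : Span UA (F.F₀ Y) (F.F₀ Y')) →
                  IsWeakening (UX.U₀ Y) (UX.U₀ Y') R → Tabulates UX R s →
                  Tabulates UA (LiftRel UX UA F s) t →
                  (LiftRel UA UX G t · θ Y) ≐ (θ Y' · R)
      κ : ∀ B → ∣ UA.U₀ B ∣ → ∣ UA.U₀ (F.F₀ (G.F₀ B)) ∣ → Set
      κ⁻¹ : ∀ B → ∣ UA.U₀ (F.F₀ (G.F₀ B)) ∣ → ∣ UA.U₀ B ∣ → Set
      κ-rel : ∀ B → IsCRel UA (κ B)
      κ⁻¹-rel : ∀ B → IsCRel UA (κ⁻¹ B)
      κ⁻¹κ : ∀ B → (κ⁻¹ B · κ B) ≐ ord (UA.U₀ B)
      κκ⁻¹ : ∀ B → (κ B · κ⁻¹ B) ≐ ord (UA.U₀ (F.F₀ (G.F₀ B)))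
      κ-natural : ∀ {B B'} (R : ∣ UA.U₀ B ∣ → ∣ UA.U₀ B' ∣ → Set)
                  (s : Span UA B B') (t : Span UX (G.F₀ B) (G.F₀ B')) →
                  IsWeakening (UA.U₀ B) (UA.U₀ B') R → Tabulates UA R s →
                  Tabulates UX (LiftRel UA UX G s) t →
                  (LiftRel UX UA F t · κ B) ≐ (κ B' · R)
      F̄-maps : ∀ {Y Y'} (f : X.Hom Y Y') (s : Span UX Y Y') →
               Tabulates UX (lowerStar (UX.U₀ Y') (UX.U₁ f)) s →
               LiftRel UX UA F s ≐ upperStar (UA.U₀ (F.F₀ Y)) (UA.U₁ (F.F₁ f))
      Ḡ-maps : ∀ {B B'} (g : A.Hom B B') (s : Span UA B' B) →
               Tabulates UA (upperStar (UA.U₀ B') (UA.U₁ g)) s →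
               LiftRel UA UX G s ≐ lowerStar (UX.U₀ (G.F₀ B)) (UX.U₁ (G.F₁ g))

-- A relation r tabulated by (p , q) is sent to F̄ r = (Fq)^* · (Fp)_*, the comma relation of
-- (Fp , Fq). If r ⊆ r', the (surjection, embedding) diagonal yields an arrow between the apexes
-- of their tabulations over which the legs factor; applying F shows F̄ r' ⊆ F̄ r, and in
-- particular that F̄ r does not depend on the tabulation. The tabulation of a composite s · r is
-- the image of the pullback P of the tabulations of r and s: the comparison P → W is a
-- surjection, so F sends it to an embedding, while F sends the exact pullback square to the
-- equation F̄ s · F̄ r = (Fπ₂)^* · (Fπ₁)_*. Identities and graphs f_*, g^* are comma relations
-- f ↓ g, whose tabulations form exact squares with (f , g); this computes F̄ on maps. The unit
-- and counit of the dual equivalence, taken as graphs η_*, are the required isomorphisms.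
module Submission where

open import Data.Product using (Σ-syntax; _×_; _,_; proj₁; proj₂; swap)
open import Relation.Binary.Bundles using (Poset)
open import Defs

module _ (P : Pos) where
  private module P = Poset P

  refl : ∀ {x} → P ∋ x ≤ x
  refl = P.refl

  trans : ∀ {x y z} → P ∋ x ≤ y → P ∋ y ≤ z → P ∋ x ≤ z
  trans = P.trans

  antisym : ∀ {x y} → P ∋ x ≤ y → P ∋ y ≤ x → P ∋ x ≈ y
  antisym = P.antisym

  ≈-sym : ∀ {x y} → P ∋ x ≈ y → P ∋ y ≈ x
  ≈-sym = P.Eq.sym

  ≈-trans : ∀ {x y z} → P ∋ x ≈ y → P ∋ y ≈ z → P ∋ x ≈ z
  ≈-trans = P.Eq.trans

  ≈⇒≤ : ∀ {x y} → P ∋ x ≈ y → P ∋ x ≤ y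
  ≈⇒≤ = P.reflexive

  ≈⇒≥ : ∀ {x y} → P ∋ x ≈ y → P ∋ y ≤ x
  ≈⇒≥ x≈y = P.reflexive (P.Eq.sym x≈y)

  ≤-resp-≈ : ∀ {x x' y' y} → P ∋ x ≈ x' → P ∋ x' ≤ y' → P ∋ y' ≈ y → P ∋ x ≤ y
  ≤-resp-≈ x≈x' x'≤y' y'≈y = trans (≈⇒≤ x≈x') (trans x'≤y' (≈⇒≤ y'≈y))

module _ {A B : Set} where

  ⊆-refl : {R : A → B → Set} → R ⊆ R
  ⊆-refl _ _ r = r

  ≐-sym : {R S : A → B → Set} → R ≐ S → S ≐ R
  ≐-sym = swap

  ≐-trans : {R S T : A → B → Set} → R ≐ S → S ≐ T → R ≐ T
  ≐-trans (R⊆S , S⊆R) (S⊆T , T⊆S) =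
    (λ a b r → S⊆T a b (R⊆S a b r)) , (λ a b t → S⊆R a b (T⊆S a b t))

·-congˡ : {A B C : Set} {R : A → B → Set} {S S' : B → C → Set} → S ≐ S' → S · R ≐ S' · R
·-congˡ (S⊆S' , S'⊆S) =
  (λ { a c (b , r , s) → b , r , S⊆S' b c s }) , (λ { a c (b , r , s) → b , r , S'⊆S b c s })

·-congʳ : {A B C : Set} {R R' : A → B → Set} {S : B → C → Set} → R ≐ R' → S · R ≐ S · R'
·-congʳ (R⊆R' , R'⊆R) =
  (λ { a c (b , r , s) → b , R⊆R' a b r , s }) , (λ { a c (b , r , s) → b , R'⊆R a b r , s })

IsWeakening-resp-≐ : (P Q : Pos) {R S : ∣ P ∣ → ∣ Q ∣ → Set} →
                     R ≐ S → IsWeakening P Q R → IsWeakening P Q S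
IsWeakening-resp-≐ P Q (R⊆S , S⊆R) weak a'≤a s b≤b' = R⊆S _ _ (weak a'≤a (S⊆R _ _ s) b≤b')

module _ (P Q : Pos) {R : ∣ P ∣ → ∣ Q ∣ → Set} (weak : IsWeakening P Q R) where

  ·-identityˡ : ord Q · R ≐ R
  ·-identityˡ = (λ { a b (b' , r , b'≤b) → weak (refl P) r b'≤b }) , (λ a b r → b , r , refl Q)

  ·-identityʳ : R · ord P ≐ R
  ·-identityʳ = (λ { a b (a' , a≤a' , r) → weak a≤a' r (refl Q) }) , (λ a b r → a , refl P , r)

comma : {A B : Set} (Q : Pos) → (A → ∣ Q ∣) → (B → ∣ Q ∣) → A → B → Set
comma Q f g a b = Q ∋ f a ≤ g b

module _ (P Q : Pos) {f : ∣ P ∣ → ∣ Q ∣} (f-mono : IsMonotone P Q f) where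

  lowerStar-weakening : IsWeakening P Q (lowerStar Q f)
  lowerStar-weakening a'≤a fa≤b b≤b' = trans Q (f-mono a'≤a) (trans Q fa≤b b≤b')

  upperStar-weakening : IsWeakening Q P (upperStar Q f)
  upperStar-weakening b'≤b b≤fa a≤a' = trans Q b'≤b (trans Q b≤fa (f-mono a≤a'))

module _ {A B : Set} (Q : Pos) {f : A → ∣ Q ∣} {g : B → ∣ Q ∣} where

  comma-≐-· : comma Q f g ≐ upperStar Q g · lowerStar Q f
  comma-≐-· = (λ a b fa≤gb → f a , refl Q , fa≤gb) , (λ { a b (c , fa≤c , c≤gb) → trans Q fa≤c c≤gb })

module _ (Q : Pos) {i : ∣ Q ∣ → ∣ Q ∣} (i≈id : ∀ x → Q ∋ i x ≈ x) where

  lowerStar-≐-ord : lowerStar Q i ≐ ord Q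
  lowerStar-≐-ord = (λ a b ia≤b → trans Q (≈⇒≥ Q (i≈id a)) ia≤b) ,
                    (λ a b a≤b → trans Q (≈⇒≤ Q (i≈id a)) a≤b)

  upperStar-≐-ord : upperStar Q i ≐ ord Q
  upperStar-≐-ord = (λ b a b≤ia → trans Q b≤ia (≈⇒≤ Q (i≈id a))) ,
                    (λ b a b≤a → trans Q b≤a (≈⇒≥ Q (i≈id a)))

lowerStar-inverse : (P Q : Pos) {f : ∣ P ∣ → ∣ Q ∣} {g : ∣ Q ∣ → ∣ P ∣} →
                    IsMonotone Q P g → (∀ x → P ∋ g (f x) ≈ x) →
                    lowerStar P g · lowerStar Q f ≐ ord P
lowerStar-inverse P Q {f} g-mono gf≈id =
  (λ { x y (z , fx≤z , gz≤y) → trans P (≈⇒≥ P (gf≈id x)) (trans P (g-mono fx≤z) gz≤y) }) ,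
  (λ x y x≤y → f x , refl Q , trans P (≈⇒≤ P (gf≈id x)) x≤y)

module ConcreteProperties {C : PosCat} (U : Concrete C) where
  open PosCat C
  open Concrete U

  U-≈ : ∀ {A B} {f g : Hom A B} → f ≈ g → ∀ x → U₀ B ∋ U₁ f x ≈ U₁ g x
  U-≈ {B = B} (f≤g , g≤f) x = antisym (U₀ B) (U-≤ f≤g x) (U-≤ g≤f x)

  U-cong : ∀ {A B} (f : Hom A B) {x y} → U₀ A ∋ x ≈ y → U₀ B ∋ U₁ f x ≈ U₁ f y
  U-cong {A} {B} f x≈y =
    antisym (U₀ B) (U₁-mono f (≈⇒≤ (U₀ A) x≈y)) (U₁-mono f (≈⇒≥ (U₀ A) x≈y))

  U-reflect-≈ : ∀ {A B} {f g : Hom A B} → (∀ x → U₀ B ∋ U₁ f x ≈ U₁ g x) → f ≈ g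
  U-reflect-≈ {B = B} f≈g =
    U-reflect (λ x → ≈⇒≤ (U₀ B) (f≈g x)) , U-reflect (λ x → ≈⇒≥ (U₀ B) (f≈g x))

  U-triangle : ∀ {W A Z} {f : Hom A Z} {p : Hom W A} {h : Hom W Z} →
               f ∘ p ≈ h → ∀ w → U₀ Z ∋ U₁ f (U₁ p w) ≈ U₁ h w
  U-triangle {Z = Z} {f} {p} fp≈h w = ≈-trans (U₀ Z) (≈-sym (U₀ Z) (U-∘ f p w)) (U-≈ fp≈h w)

  U-square : ∀ {W A A' Z} {f : Hom A Z} {p : Hom W A} {g : Hom A' Z} {q : Hom W A'} →
             f ∘ p ≈ g ∘ q → ∀ w → U₀ Z ∋ U₁ f (U₁ p w) ≈ U₁ g (U₁ q w)
  U-square {Z = Z} {g = g} {q} fp≈gq w = ≈-trans (U₀ Z) (U-triangle fp≈gq w) (U-∘ g q w)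

  IsJointlyOrderReflecting : ∀ {W A B} → Hom W A → Hom W B → Set
  IsJointlyOrderReflecting {W} {A} {B} l r =
    ∀ w w' → U₀ A ∋ U₁ l w ≤ U₁ l w' → U₀ B ∋ U₁ r w ≤ U₁ r w' → U₀ W ∋ w ≤ w'

  jointly-injective : ∀ {W A B} {l : Hom W A} {r : Hom W B} → IsJointlyOrderReflecting l r →
                      ∀ {w w'} → U₀ A ∋ U₁ l w ≈ U₁ l w' → U₀ B ∋ U₁ r w ≈ U₁ r w' →
                      U₀ W ∋ w ≈ w'
  jointly-injective {W} {A} {B} reflecting lw≈lw' rw≈rw' =
    antisym (U₀ W) (reflecting _ _ (≈⇒≤ (U₀ A) lw≈lw') (≈⇒≤ (U₀ B) rw≈rw'))
                   (reflecting _ _ (≈⇒≥ (U₀ A) lw≈lw') (≈⇒≥ (U₀ B) rw≈rw'))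

  commaRel : ∀ {A B Z} → Hom A Z → Hom B Z → ∣ U₀ A ∣ → ∣ U₀ B ∣ → Set
  commaRel {Z = Z} f g = comma (U₀ Z) (U₁ f) (U₁ g)

  lowerStar-≐-commaRel : ∀ {A B} (f : Hom A B) → lowerStar (U₀ B) (U₁ f) ≐ commaRel f id
  lowerStar-≐-commaRel {A} {B} f =
    ≐-sym (≐-trans (comma-≐-· (U₀ B))
            (≐-trans (·-congˡ (upperStar-≐-ord (U₀ B) U-id))
                     (·-identityˡ (U₀ A) (U₀ B) (lowerStar-weakening (U₀ A) (U₀ B) (U₁-mono f)))))

  upperStar-≐-commaRel : ∀ {A B} (g : Hom A B) → upperStar (U₀ B) (U₁ g) ≐ commaRel id g
  upperStar-≐-commaRel {A} {B} g =
    ≐-sym (≐-trans (comma-≐-· (U₀ B))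
            (≐-trans (·-congʳ (lowerStar-≐-ord (U₀ B) U-id))
                     (·-identityʳ (U₀ B) (U₀ A) (upperStar-weakening (U₀ A) (U₀ B) (U₁-mono g)))))

  Tabulates-resp-≐ : ∀ {A B} {R S : ∣ U₀ A ∣ → ∣ U₀ B ∣ → Set} (s : Span U A B) →
                     R ≐ S → Tabulates U R s → Tabulates U S s
  Tabulates-resp-≐ s (R⊆S , S⊆R) (surjective , in-R , reflecting) =
    (λ a b r → surjective a b (S⊆R a b r)) , (λ w → R⊆S _ _ (in-R w)) , reflecting

  IsCRel-resp-≐ : ∀ {A B} {R S : ∣ U₀ A ∣ → ∣ U₀ B ∣ → Set} → R ≐ S → IsCRel U R → IsCRel U S
  IsCRel-resp-≐ {A} {B} R≐S (weak , s , tab) =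
    IsWeakening-resp-≐ (U₀ A) (U₀ B) R≐S weak , s , Tabulates-resp-≐ s R≐S tab

  tabulation-exact : ∀ {A B Z} (s : Span U A B) (f : Hom A Z) (g : Hom B Z) →
                     Tabulates U (commaRel f g) s →
                     IsExactSquare U (Span.left s) (Span.right s) f g
  tabulation-exact {A} {B} {Z} s f g (surjective , in-R , _) =
    U-reflect (λ w → ≤-resp-≈ (U₀ Z) (U-∘ f left w) (in-R w) (≈-sym (U₀ Z) (U-∘ g right w))) ,
    λ x y fx≤gy → let (w , lw≈x , rw≈y) = surjective x y fx≤gy
                  in w , ≈⇒≥ (U₀ A) lw≈x , ≈⇒≤ (U₀ B) rw≈y
    where open Span s

  pullback-exact : ∀ {A B B'} {R : ∣ U₀ A ∣ → ∣ U₀ B ∣ → Set} (s : Span U A B) →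
                   IsWeakening (U₀ A) (U₀ B) R → Tabulates U R s →
                   (g : Hom B' B) (P : Pullback U (Span.right s) g) →
                   IsExactSquare U (Pullback.π₁ P) (Pullback.π₂ P) (Span.right s) g
  pullback-exact {A} {B} {B'} s weak (surjective , in-R , reflecting) g P = proj₁ commutes , witness
    where
      open Span s
      open Pullback P using (π₁; π₂; commutes; U-universal)
      witness : ∀ x y → U₀ B ∋ U₁ right x ≤ U₁ g y →
                Σ[ p ∈ ∣ U₀ (Pullback.P P) ∣ ] ((U₀ apex ∋ x ≤ U₁ π₁ p) × (U₀ B' ∋ U₁ π₂ p ≤ y))
      witness x y rx≤gy =
        let (x' , lx'≈lx , rx'≈gy) = surjective _ _ (weak (refl (U₀ A)) (in-R x) rx≤gy)
            x≤x' = reflecting x x' (≈⇒≥ (U₀ A) lx'≈lx) (trans (U₀ B) rx≤gy (≈⇒≥ (U₀ B) rx'≈gy))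
            (p , π₁p≈x' , π₂p≈y) = U-universal x' y rx'≈gy
        in p , trans (U₀ apex) x≤x' (≈⇒≥ (U₀ apex) π₁p≈x') , ≈⇒≤ (U₀ B') π₂p≈y

module OrderRegularProperties (𝒞 : OrderRegular) where
  open OrderRegular 𝒞 renaming (cat to C; U to UC)
  open PosCat C
  open Concrete UC hiding (U-reflect)
  open ConcreteProperties UC
  open IsOrderRegular isOrderRegular
  open IsFactorisationSystem factorisation

  module Product (A B : Obj) where
    open Terminal terminal using (!; !-unique)
    open Pullback (pullback (! A) (! B)) public

    ⟨_,_⟩ : ∀ {W} → Hom W A → Hom W B → Hom W P
    ⟨ l , r ⟩ = proj₁ (universal l r (!-unique _ _ , !-unique _ _))

    π₁-⟨,⟩ : ∀ {W} (l : Hom W A) (r : Hom W B) w → U₀ A ∋ U₁ π₁ (U₁ ⟨ l , r ⟩ w) ≈ U₁ l w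
    π₁-⟨,⟩ l r = U-triangle (proj₁ (proj₂ (universal l r (!-unique _ _ , !-unique _ _))))

    π₂-⟨,⟩ : ∀ {W} (l : Hom W A) (r : Hom W B) w → U₀ B ∋ U₁ π₂ (U₁ ⟨ l , r ⟩ w) ≈ U₁ r w
    π₂-⟨,⟩ l r = U-triangle (proj₂ (proj₂ (universal l r (!-unique _ _ , !-unique _ _))))

    ⟨,⟩-cong : ∀ {W V} {l : Hom W A} {r : Hom W B} {l' : Hom V A} {r' : Hom V B} {w v} →
               U₀ A ∋ U₁ l w ≈ U₁ l' v → U₀ B ∋ U₁ r w ≈ U₁ r' v →
               U₀ P ∋ U₁ ⟨ l , r ⟩ w ≈ U₁ ⟨ l' , r' ⟩ v
    ⟨,⟩-cong {l = l} {r} {l'} {r'} {w} {v} lw≈l'v rw≈r'v = jointly-injective U-reflect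
      (≈-trans (U₀ A) (π₁-⟨,⟩ l r w) (≈-trans (U₀ A) lw≈l'v (≈-sym (U₀ A) (π₁-⟨,⟩ l' r' v))))
      (≈-trans (U₀ B) (π₂-⟨,⟩ l r w) (≈-trans (U₀ B) rw≈r'v (≈-sym (U₀ B) (π₂-⟨,⟩ l' r' v))))

    ⟨,⟩-injective : ∀ {W V} {l : Hom W A} {r : Hom W B} {l' : Hom V A} {r' : Hom V B} {w v} →
                    U₀ P ∋ U₁ ⟨ l , r ⟩ w ≈ U₁ ⟨ l' , r' ⟩ v →
                    (U₀ A ∋ U₁ l w ≈ U₁ l' v) × (U₀ B ∋ U₁ r w ≈ U₁ r' v)
    ⟨,⟩-injective {l = l} {r} {l'} {r'} {w} {v} pair≈pair' =
      ≈-trans (U₀ A) (≈-sym (U₀ A) (π₁-⟨,⟩ l r w)) (≈-trans (U₀ A) (U-cong π₁ pair≈pair') (π₁-⟨,⟩ l' r' v)) ,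
      ≈-trans (U₀ B) (≈-sym (U₀ B) (π₂-⟨,⟩ l r w)) (≈-trans (U₀ B) (U-cong π₂ pair≈pair') (π₂-⟨,⟩ l' r' v))

    ⟨,⟩-embedding : ∀ {W} {l : Hom W A} {r : Hom W B} →
                    IsJointlyOrderReflecting l r → IsEmbeddingC UC ⟨ l , r ⟩
    ⟨,⟩-embedding {l = l} {r} reflecting w w' pair≤pair' = reflecting w w'
      (≤-resp-≈ (U₀ A) (≈-sym (U₀ A) (π₁-⟨,⟩ l r w)) (U₁-mono π₁ pair≤pair') (π₁-⟨,⟩ l r w'))
      (≤-resp-≈ (U₀ B) (≈-sym (U₀ B) (π₂-⟨,⟩ l r w)) (U₁-mono π₂ pair≤pair') (π₂-⟨,⟩ l r w'))

  -- ⟨ left , right ⟩ is an embedding and ⟨ a , b ⟩ pulls back along it to a surjection onto V,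
  -- so the diagonal of that square is the factorisation.
  factor-through-tabulation :
    ∀ {A B V} {R : ∣ U₀ A ∣ → ∣ U₀ B ∣ → Set} (s : Span UC A B) → Tabulates UC R s →
    (a : Hom V A) (b : Hom V B) → (∀ v → R (U₁ a v) (U₁ b v)) →
    Σ[ d ∈ Hom V (Span.apex s) ] ((Span.left s ∘ d ≈ a) × (Span.right s ∘ d ≈ b))
  factor-through-tabulation {A} {B} {V} s (surjective , _ , reflecting) a b ab∈R =
    d , U-reflect-≈ (λ v → proj₁ (legs v)) , U-reflect-≈ (λ v → proj₂ (legs v))
    where
      open Span s
      open Product A B using (⟨_,_⟩; ⟨,⟩-cong; ⟨,⟩-injective; ⟨,⟩-embedding)
      module Q = Pullback (pullback ⟨ a , b ⟩ ⟨ left , right ⟩)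
      π₁-surjective : IsSurjectionC UC Q.π₁
      π₁-surjective v =
        let (w , lw≈av , rw≈bv) = surjective _ _ (ab∈R v)
            (q , π₁q≈v , _) = Q.U-universal v w
              (⟨,⟩-cong (≈-sym (U₀ A) lw≈av) (≈-sym (U₀ B) rw≈bv))
        in q , π₁q≈v
      fill : Σ[ d ∈ Hom V apex ] ((d ∘ Q.π₁ ≈ Q.π₂) × (⟨ left , right ⟩ ∘ d ≈ ⟨ a , b ⟩))
      fill = diagonal Q.π₁ ⟨ left , right ⟩ Q.π₂ ⟨ a , b ⟩ π₁-surjective
               (⟨,⟩-embedding reflecting) (swap Q.commutes)
      d : Hom V apex
      d = proj₁ fill
      legs : ∀ v → (U₀ A ∋ U₁ (left ∘ d) v ≈ U₁ a v) × (U₀ B ∋ U₁ (right ∘ d) v ≈ U₁ b v)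
      legs v =
        let (ldv≈av , rdv≈bv) = ⟨,⟩-injective (U-triangle (proj₂ (proj₂ fill)) v)
        in ≈-trans (U₀ A) (U-∘ left d v) ldv≈av , ≈-trans (U₀ B) (U-∘ right d v) rdv≈bv

  -- A tabulation of S · R is the image of the pullback of tabulations of R and S.
  module CompositeTabulation {A B Z} {R : ∣ U₀ A ∣ → ∣ U₀ B ∣ → Set} {S : ∣ U₀ B ∣ → ∣ U₀ Z ∣ → Set}
           (s : Span UC A B) (t : Span UC B Z) (u : Span UC A Z)
           (R-weak : IsWeakening (U₀ A) (U₀ B) R) (S-weak : IsWeakening (U₀ B) (U₀ Z) S)
           (tabR : Tabulates UC R s) (tabS : Tabulates UC S t) (tabSR : Tabulates UC (S · R) u) where
    private
      module s = Span s
      module t = Span t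
      module u = Span u

    square : Pullback UC s.right t.left
    square = pullback s.right t.left

    private
      module P = Pullback square

      in-composite : ∀ p → (S · R) (U₁ (s.left ∘ P.π₁) p) (U₁ (t.right ∘ P.π₂) p)
      in-composite p =
        U₁ s.right (U₁ P.π₁ p) ,
        R-weak (≈⇒≤ (U₀ A) (U-∘ s.left P.π₁ p)) (proj₁ (proj₂ tabR) _) (refl (U₀ B)) ,
        S-weak (≈⇒≤ (U₀ B) (U-square P.commutes p)) (proj₁ (proj₂ tabS) _) (≈⇒≥ (U₀ Z) (U-∘ t.right P.π₂ p))

      factors : Σ[ d ∈ Hom P.P u.apex ] ((u.left ∘ d ≈ s.left ∘ P.π₁) × (u.right ∘ d ≈ t.right ∘ P.π₂))
      factors = factor-through-tabulation u tabSR (s.left ∘ P.π₁) (t.right ∘ P.π₂) in-composite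

    comparison : Hom P.P u.apex
    comparison = proj₁ factors

    comparison-left : u.left ∘ comparison ≈ s.left ∘ P.π₁
    comparison-left = proj₁ (proj₂ factors)

    comparison-right : u.right ∘ comparison ≈ t.right ∘ P.π₂
    comparison-right = proj₂ (proj₂ factors)

    comparison-surjective : IsSurjectionC UC comparison
    comparison-surjective w =
      let (b , Rab , Sbc) = proj₁ (proj₂ tabSR) w
          (ws , lws≈ , rws≈b) = proj₁ tabR _ _ Rab
          (wt , lwt≈b , rwt≈) = proj₁ tabS _ _ Sbc
          (p , π₁p≈ws , π₂p≈wt) = P.U-universal ws wt (≈-trans (U₀ B) rws≈b (≈-sym (U₀ B) lwt≈b))
      in p , jointly-injective (proj₂ (proj₂ tabSR))
        (≈-trans (U₀ A) (U-triangle comparison-left p)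
          (≈-trans (U₀ A) (U-∘ s.left P.π₁ p) (≈-trans (U₀ A) (U-cong s.left π₁p≈ws) lws≈)))
        (≈-trans (U₀ Z) (U-triangle comparison-right p)
          (≈-trans (U₀ Z) (U-∘ t.right P.π₂ p) (≈-trans (U₀ Z) (U-cong t.right π₂p≈wt) rwt≈)))

  -- The comma object: a point is (a , z , b) with z ∈ Z² an arrow f a → g b.
  module CommaObject {A B Z} (f : Hom A Z) (g : Hom B Z) where
    private
      module Z² = Power2 (power2 Z)
      module P₁ = Pullback (pullback f Z².d₀)
      module P₂ = Pullback (pullback (Z².d₁ ∘ P₁.π₂) g)

    span : Span UC A B
    span = record { apex = P₂.P ; left = P₁.π₁ ∘ P₂.π₁ ; right = P₂.π₂ }

    private
      a-of : ∣ U₀ P₂.P ∣ → ∣ U₀ A ∣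
      a-of p = U₁ P₁.π₁ (U₁ P₂.π₁ p)

      z-of : ∣ U₀ P₂.P ∣ → ∣ U₀ Z².P ∣
      z-of p = U₁ P₁.π₂ (U₁ P₂.π₁ p)

      d₀-z : ∀ p → U₀ Z ∋ U₁ Z².d₀ (z-of p) ≈ U₁ f (a-of p)
      d₀-z p = ≈-sym (U₀ Z) (U-square P₁.commutes (U₁ P₂.π₁ p))

      d₁-z : ∀ p → U₀ Z ∋ U₁ Z².d₁ (z-of p) ≈ U₁ g (U₁ P₂.π₂ p)
      d₁-z p = ≈-trans (U₀ Z) (≈-sym (U₀ Z) (U-∘ Z².d₁ P₁.π₂ (U₁ P₂.π₁ p))) (U-square P₂.commutes p)

      fa≤gb-of : ∀ p → U₀ Z ∋ U₁ f (a-of p) ≤ U₁ g (U₁ P₂.π₂ p)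
      fa≤gb-of p = ≤-resp-≈ (U₀ Z) (≈-sym (U₀ Z) (d₀-z p)) (U-≤ Z².d₀≤d₁ (z-of p)) (d₁-z p)

      surjective : ∀ a b → commaRel f g a b →
                   Σ[ p ∈ ∣ U₀ P₂.P ∣ ] ((U₀ A ∋ U₁ (Span.left span) p ≈ a) × (U₀ B ∋ U₁ P₂.π₂ p ≈ b))
      surjective a b fa≤gb =
        let (z , d₀z≈fa , d₁z≈gb) = Z².U-universal (U₁ f a) (U₁ g b) fa≤gb
            (p₁ , π₁p₁≈a , π₂p₁≈z) = P₁.U-universal a z (≈-sym (U₀ Z) d₀z≈fa)
            (p , π₁p≈p₁ , π₂p≈b) = P₂.U-universal p₁ b
              (≈-trans (U₀ Z) (U-∘ Z².d₁ P₁.π₂ p₁) (≈-trans (U₀ Z) (U-cong Z².d₁ π₂p₁≈z) d₁z≈gb))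
        in p , ≈-trans (U₀ A) (U-∘ P₁.π₁ P₂.π₁ p) (≈-trans (U₀ A) (U-cong P₁.π₁ π₁p≈p₁) π₁p₁≈a) , π₂p≈b

      reflecting : IsJointlyOrderReflecting (Span.left span) P₂.π₂
      reflecting p p' lp≤lp' bp≤bp' = P₂.U-reflect p p' (P₁.U-reflect _ _ ap≤ap' zp≤zp') bp≤bp'
        where
          ap≤ap' : U₀ A ∋ a-of p ≤ a-of p'
          ap≤ap' = ≤-resp-≈ (U₀ A) (≈-sym (U₀ A) (U-∘ P₁.π₁ P₂.π₁ p)) lp≤lp' (U-∘ P₁.π₁ P₂.π₁ p')
          zp≤zp' : U₀ Z².P ∋ z-of p ≤ z-of p'
          zp≤zp' = Z².U-reflect _ _
            (≤-resp-≈ (U₀ Z) (d₀-z p) (U₁-mono f ap≤ap') (≈-sym (U₀ Z) (d₀-z p')))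
            (≤-resp-≈ (U₀ Z) (d₁-z p) (U₁-mono g bp≤bp') (≈-sym (U₀ Z) (d₁-z p')))

    tabulates : Tabulates UC (commaRel f g) span
    tabulates = surjective ,
                (λ p → trans (U₀ Z) (≈⇒≤ (U₀ Z) (U-cong f (U-∘ P₁.π₁ P₂.π₁ p))) (fa≤gb-of p)) ,
                reflecting

  comma-isCRel : ∀ {A B Z} (f : Hom A Z) (g : Hom B Z) → IsCRel UC (commaRel f g)
  comma-isCRel {Z = Z} f g =
    (λ a'≤a fa≤gb b≤b' → trans (U₀ Z) (U₁-mono f a'≤a) (trans (U₀ Z) fa≤gb (U₁-mono g b≤b'))) ,
    CommaObject.span f g , CommaObject.tabulates f g

module Extension (𝒞 𝒟 : OrderRegular)
                 (H : DualFunctor (OrderRegular.cat 𝒞) (OrderRegular.cat 𝒟))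
                 (H-exact : PreservesExactSquares (OrderRegular.U 𝒞) (OrderRegular.U 𝒟) H)
                 (H-surj-emb : SurjectionsToEmbeddings (OrderRegular.U 𝒞) (OrderRegular.U 𝒟) H) where
  private
    C : PosCat
    C = OrderRegular.cat 𝒞
    UC : Concrete C
    UC = OrderRegular.U 𝒞
    UD : Concrete (OrderRegular.cat 𝒟)
    UD = OrderRegular.U 𝒟
    module C = PosCat C
    module UC = Concrete UC
    module UD = Concrete UD
    module CP = ConcreteProperties UC
    module DP = ConcreteProperties UD
    module CR = OrderRegularProperties 𝒞
    module DR = OrderRegularProperties 𝒟
  open DualFunctor H

  private
    H∣_∣ : C.Obj → Pos
    H∣ A ∣ = UD.U₀ (F₀ A)

    H-∘ : ∀ {A B Z} (g : C.Hom B Z) (f : C.Hom A B) a →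
          H∣ A ∣ ∋ UD.U₁ (F₁ (g C.∘ f)) a ≈ UD.U₁ (F₁ f) (UD.U₁ (F₁ g) a)
    H-∘ {A} g f a = ≈-trans H∣ A ∣ (DP.U-≈ (F-∘ g f) a) (UD.U-∘ (F₁ f) (F₁ g) a)

    H-triangle : ∀ {W V A} {l' : C.Hom V A} {d : C.Hom W V} {l : C.Hom W A} →
                 l' C.∘ d C.≈ l → ∀ a → H∣ W ∣ ∋ UD.U₁ (F₁ d) (UD.U₁ (F₁ l') a) ≈ UD.U₁ (F₁ l) a
    H-triangle {W} {l' = l'} {d} (l'd≤l , l≤l'd) a =
      ≈-trans H∣ W ∣ (≈-sym H∣ W ∣ (H-∘ l' d a)) (DP.U-≈ (F-mono l'd≤l , F-mono l≤l'd) a)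

    H-square : ∀ {W V A B} {l' : C.Hom V A} {d : C.Hom W V} {m : C.Hom B A} {n : C.Hom W B} →
               l' C.∘ d C.≈ m C.∘ n → ∀ a →
               H∣ W ∣ ∋ UD.U₁ (F₁ d) (UD.U₁ (F₁ l') a) ≈ UD.U₁ (F₁ n) (UD.U₁ (F₁ m) a)
    H-square {W} {m = m} {n} l'd≈mn a = ≈-trans H∣ W ∣ (H-triangle l'd≈mn a) (H-∘ m n a)

    H-id : ∀ {A} a → H∣ A ∣ ∋ UD.U₁ (F₁ (C.id {A})) a ≈ a
    H-id {A} a = ≈-trans H∣ A ∣ (DP.U-≈ F-id a) (UD.U-id a)

  H̄ : ∀ {A B} → Span UC A B → ∣ H∣ A ∣ ∣ → ∣ H∣ B ∣ ∣ → Set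
  H̄ = LiftRel UC UD H

  H̄-exact : ∀ {A B Z} (s : Span UC A B) (f : C.Hom A Z) (g : C.Hom B Z) →
            Tabulates UC (CP.commaRel f g) s →
            H̄ s ≐ lowerStar H∣ B ∣ (UD.U₁ (F₁ g)) · upperStar H∣ A ∣ (UD.U₁ (F₁ f))
  H̄-exact s f g tab =
    ≐-trans (comma-≐-· H∣ Span.apex s ∣) (H-exact _ _ f g (CP.tabulation-exact s f g tab))

  H̄-antitone : ∀ {A B} {R R' : ∣ UC.U₀ A ∣ → ∣ UC.U₀ B ∣ → Set} (s s' : Span UC A B) →
               Tabulates UC R s → Tabulates UC R' s' → R ⊆ R' → H̄ s' ⊆ H̄ s
  H̄-antitone s s' (_ , in-R , _) tab' R⊆R' a b H̄s'ab
    with CR.factor-through-tabulation s' tab' (Span.left s) (Span.right s) (λ w → R⊆R' _ _ (in-R w))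
  ... | d , left-factors , right-factors =
    ≤-resp-≈ H∣ Span.apex s ∣ (≈-sym H∣ Span.apex s ∣ (H-triangle left-factors a))
             (UD.U₁-mono (F₁ d) H̄s'ab) (H-triangle right-factors b)

  -- H reflects the order along the surjective comparison, reducing H̄ u to the exact pullback square.
  H̄-∘ : ∀ {A B Z} {R : ∣ UC.U₀ A ∣ → ∣ UC.U₀ B ∣ → Set} {S : ∣ UC.U₀ B ∣ → ∣ UC.U₀ Z ∣ → Set}
        (s : Span UC A B) (t : Span UC B Z) (u : Span UC A Z) →
        IsWeakening (UC.U₀ A) (UC.U₀ B) R → IsWeakening (UC.U₀ B) (UC.U₀ Z) S →
        Tabulates UC R s → Tabulates UC S t → Tabulates UC (S · R) u →
        H̄ u ≐ H̄ t · H̄ s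
  H̄-∘ s t u R-weak S-weak tabR tabS tabSR =
    (λ a c H̄uac → proj₁ exact _ _ (_ , refl H∣ P ∣ , H̄u⇒comma a c H̄uac)) ,
    (λ { a c H̄tsac → let (_ , ≤z , z≤) = proj₂ exact _ _ H̄tsac in comma⇒H̄u a c (trans H∣ P ∣ ≤z z≤) })
    where
      module s = Span s
      module t = Span t
      open CR.CompositeTabulation s t u R-weak S-weak tabR tabS tabSR
      open Pullback square using (P; π₁; π₂)
      exact : upperStar H∣ P ∣ (UD.U₁ (F₁ π₂)) · lowerStar H∣ P ∣ (UD.U₁ (F₁ π₁))
              ≐ lowerStar H∣ t.apex ∣ (UD.U₁ (F₁ t.left)) · upperStar H∣ s.apex ∣ (UD.U₁ (F₁ s.right))
      exact = H-exact π₁ π₂ s.right t.left (CP.pullback-exact s R-weak tabR t.left square)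
      H̄u⇒comma : ∀ a c → H̄ u a c →
                 H∣ P ∣ ∋ UD.U₁ (F₁ π₁) (UD.U₁ (F₁ s.left) a) ≤ UD.U₁ (F₁ π₂) (UD.U₁ (F₁ t.right) c)
      H̄u⇒comma a c H̄uac = ≤-resp-≈ H∣ P ∣ (≈-sym H∣ P ∣ (H-square comparison-left a))
                            (UD.U₁-mono (F₁ comparison) H̄uac) (H-square comparison-right c)
      comma⇒H̄u : ∀ a c →
                 H∣ P ∣ ∋ UD.U₁ (F₁ π₁) (UD.U₁ (F₁ s.left) a) ≤ UD.U₁ (F₁ π₂) (UD.U₁ (F₁ t.right) c) →
                 H̄ u a c
      comma⇒H̄u a c Fπ₁≤Fπ₂ = H-surj-emb comparison comparison-surjective _ _
        (≤-resp-≈ H∣ P ∣ (H-square comparison-left a) Fπ₁≤Fπ₂ (≈-sym H∣ P ∣ (H-square comparison-right c)))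

  H̄-maps-lower : ∀ {A B} (f : C.Hom A B) (s : Span UC A B) →
                 Tabulates UC (lowerStar (UC.U₀ B) (UC.U₁ f)) s →
                 H̄ s ≐ upperStar H∣ A ∣ (UD.U₁ (F₁ f))
  H̄-maps-lower {A} {B} f s tab =
    ≐-trans (H̄-exact s f C.id (CP.Tabulates-resp-≐ s (CP.lowerStar-≐-commaRel f) tab))
            (≐-trans (·-congˡ (lowerStar-≐-ord H∣ B ∣ H-id))
                     (·-identityˡ H∣ A ∣ H∣ B ∣ (upperStar-weakening H∣ B ∣ H∣ A ∣ (UD.U₁-mono (F₁ f)))))

  H̄-maps-upper : ∀ {A B} (g : C.Hom A B) (s : Span UC B A) →
                 Tabulates UC (upperStar (UC.U₀ B) (UC.U₁ g)) s →
                 H̄ s ≐ lowerStar H∣ A ∣ (UD.U₁ (F₁ g))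
  H̄-maps-upper {A} {B} g s tab =
    ≐-trans (H̄-exact s C.id g (CP.Tabulates-resp-≐ s (CP.upperStar-≐-commaRel g) tab))
            (≐-trans (·-congʳ (upperStar-≐-ord H∣ B ∣ H-id))
                     (·-identityʳ H∣ B ∣ H∣ A ∣ (lowerStar-weakening H∣ B ∣ H∣ A ∣ (UD.U₁-mono (F₁ g)))))

  H̄-id : ∀ {A} (s : Span UC A A) → Tabulates UC (ord (UC.U₀ A)) s → H̄ s ≐ ord H∣ A ∣
  H̄-id {A} s tab =
    ≐-trans (H̄-maps-lower C.id s (CP.Tabulates-resp-≐ s (≐-sym (lowerStar-≐-ord (UC.U₀ A) UC.U-id)) tab))
            (upperStar-≐-ord H∣ A ∣ H-id)

  isRelExtension : IsRelExtension UC UD H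
  isRelExtension = record
    { well-defined = λ R s s' _ tab tab' → H̄-antitone s' s tab' tab ⊆-refl , H̄-antitone s s' tab tab' ⊆-refl
    ; is-relation = λ R s _ _ → DR.comma-isCRel (F₁ (Span.left s)) (F₁ (Span.right s))
    ; preserves-id = H̄-id
    ; preserves-∘ = λ R S s t u → H̄-∘ s t u
    ; antitone = λ R R' s s' _ _ → H̄-antitone s s'
    }

IsDualEquivalence-swap : ∀ {C D} {F : DualFunctor C D} {G : DualFunctor D C} →
                         IsDualEquivalence F G → IsDualEquivalence G F
IsDualEquivalence-swap eqv = record
  { η = ε ; η⁻¹ = ε⁻¹ ; η⁻¹η = ε⁻¹ε ; ηη⁻¹ = εε⁻¹ ; η-natural = ε-natural
  ; ε = η ; ε⁻¹ = η⁻¹ ; ε⁻¹ε = η⁻¹η ; εε⁻¹ = ηη⁻¹ ; ε-natural = η-natural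
  }
  where open IsDualEquivalence eqv

module UnitIsomorphism (𝒞 𝒟 : OrderRegular)
                       (H : DualFunctor (OrderRegular.cat 𝒞) (OrderRegular.cat 𝒟))
                       (K : DualFunctor (OrderRegular.cat 𝒟) (OrderRegular.cat 𝒞))
                       (K-exact : PreservesExactSquares (OrderRegular.U 𝒟) (OrderRegular.U 𝒞) K)
                       (K-surj-emb : SurjectionsToEmbeddings (OrderRegular.U 𝒟) (OrderRegular.U 𝒞) K)
                       (eqv : IsDualEquivalence H K) where
  private
    C : PosCat
    C = OrderRegular.cat 𝒞
    UC : Concrete C
    UC = OrderRegular.U 𝒞
    UD : Concrete (OrderRegular.cat 𝒟)
    UD = OrderRegular.U 𝒟
    module C = PosCat C
    module UC = Concrete UC
    module CP = ConcreteProperties UC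
    module CR = OrderRegularProperties 𝒞
    module H = DualFunctor H
    module K = DualFunctor K
    module K̄ = Extension 𝒟 𝒞 K K-exact K-surj-emb
  open IsDualEquivalence eqv using (η; η⁻¹; η⁻¹η; ηη⁻¹; η-natural)

  private
    KH : C.Obj → C.Obj
    KH X = K.F₀ (H.F₀ X)

    KH₁ : ∀ {X Y} → C.Hom X Y → C.Hom (KH X) (KH Y)
    KH₁ f = K.F₁ (H.F₁ f)

    η⁻¹-η : ∀ Y y → UC.U₀ Y ∋ UC.U₁ (η⁻¹ Y) (UC.U₁ (η Y) y) ≈ y
    η⁻¹-η Y y = ≈-trans (UC.U₀ Y) (CP.U-triangle (η⁻¹η Y) y) (UC.U-id y)

    η-η⁻¹ : ∀ Y v → UC.U₀ (KH Y) ∋ UC.U₁ (η Y) (UC.U₁ (η⁻¹ Y) v) ≈ v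
    η-η⁻¹ Y v = ≈-trans (UC.U₀ (KH Y)) (CP.U-triangle (ηη⁻¹ Y) v) (UC.U-id v)

    η-reflects : ∀ Y {y y'} → UC.U₀ (KH Y) ∋ UC.U₁ (η Y) y ≤ UC.U₁ (η Y) y' → UC.U₀ Y ∋ y ≤ y'
    η-reflects Y {y} {y'} ηy≤ηy' =
      ≤-resp-≈ (UC.U₀ Y) (≈-sym (UC.U₀ Y) (η⁻¹-η Y y)) (UC.U₁-mono (η⁻¹ Y) ηy≤ηy') (η⁻¹-η Y y')

    η-natural-at : ∀ {W Y} (f : C.Hom W Y) w →
                   UC.U₀ (KH Y) ∋ UC.U₁ (KH₁ f) (UC.U₁ (η W) w) ≈ UC.U₁ (η Y) (UC.U₁ f w)
    η-natural-at f = CP.U-square (η-natural f)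

  θ : ∀ Y → ∣ UC.U₀ Y ∣ → ∣ UC.U₀ (KH Y) ∣ → Set
  θ Y = lowerStar (UC.U₀ (KH Y)) (UC.U₁ (η Y))

  θ⁻¹ : ∀ Y → ∣ UC.U₀ (KH Y) ∣ → ∣ UC.U₀ Y ∣ → Set
  θ⁻¹ Y = lowerStar (UC.U₀ Y) (UC.U₁ (η⁻¹ Y))

  θ-isCRel : ∀ Y → IsCRel UC (θ Y)
  θ-isCRel Y = CP.IsCRel-resp-≐ (≐-sym (CP.lowerStar-≐-commaRel (η Y))) (CR.comma-isCRel (η Y) C.id)

  θ⁻¹-isCRel : ∀ Y → IsCRel UC (θ⁻¹ Y)
  θ⁻¹-isCRel Y = CP.IsCRel-resp-≐ (≐-sym (CP.lowerStar-≐-commaRel (η⁻¹ Y))) (CR.comma-isCRel (η⁻¹ Y) C.id)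

  θ⁻¹θ : ∀ Y → θ⁻¹ Y · θ Y ≐ ord (UC.U₀ Y)
  θ⁻¹θ Y = lowerStar-inverse (UC.U₀ Y) (UC.U₀ (KH Y)) (UC.U₁-mono (η⁻¹ Y)) (η⁻¹-η Y)

  θθ⁻¹ : ∀ Y → θ Y · θ⁻¹ Y ≐ ord (UC.U₀ (KH Y))
  θθ⁻¹ Y = lowerStar-inverse (UC.U₀ (KH Y)) (UC.U₀ Y) (UC.U₁-mono (η Y)) (η-η⁻¹ Y)

  θ-natural : ∀ {Y Y'} (R : ∣ UC.U₀ Y ∣ → ∣ UC.U₀ Y' ∣ → Set)
              (s : Span UC Y Y') (t : Span UD (H.F₀ Y) (H.F₀ Y')) →
              IsWeakening (UC.U₀ Y) (UC.U₀ Y') R → Tabulates UC R s →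
              Tabulates UD (LiftRel UC UD H s) t →
              K̄.H̄ t · θ Y ≐ θ Y' · R
  θ-natural {Y} {Y'} R s t R-weak (surjective , in-R , _) tab = forward , backward
    where
      open Span s
      QY QY' : Pos
      QY = UC.U₀ (KH Y)
      QY' = UC.U₀ (KH Y')
      K̄t : K̄.H̄ t ≐ lowerStar QY' (UC.U₁ (KH₁ right)) · upperStar QY (UC.U₁ (KH₁ left))
      K̄t = K̄.H̄-exact t (H.F₁ left) (H.F₁ right) tab
      forward : K̄.H̄ t · θ Y ⊆ θ Y' · R
      forward y z' (z , ηy≤z , K̄tzz') =
        let (v , z≤v , v≤z') = proj₁ K̄t z z' K̄tzz'
            w = UC.U₁ (η⁻¹ apex) v
            ηw≈v = η-η⁻¹ apex v
            ηy≤ηlw = trans QY ηy≤z (trans QY z≤v (≈⇒≤ QY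
                       (≈-trans QY (CP.U-cong (KH₁ left) (≈-sym (UC.U₀ (KH apex)) ηw≈v)) (η-natural-at left w))))
        in UC.U₁ right w ,
           R-weak (η-reflects Y ηy≤ηlw) (in-R w) (refl (UC.U₀ Y')) ,
           trans QY' (≈⇒≤ QY' (≈-trans QY' (≈-sym QY' (η-natural-at right w)) (CP.U-cong (KH₁ right) ηw≈v)))
                     v≤z'
      backward : θ Y' · R ⊆ K̄.H̄ t · θ Y
      backward y z' (y' , Ryy' , ηy'≤z') =
        let (w , lw≈y , rw≈y') = surjective y y' Ryy'
        in UC.U₁ (η Y) y , refl QY , proj₂ K̄t _ z'
             (UC.U₁ (η apex) w ,
              ≈⇒≥ QY (≈-trans QY (η-natural-at left w) (CP.U-cong (η Y) lw≈y)) ,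
              trans QY' (≈⇒≤ QY' (≈-trans QY' (η-natural-at right w) (CP.U-cong (η Y') rw≈y'))) ηy'≤z')

theorem7p6 : (𝒳 𝒜 : OrderRegular)
    (F : DualFunctor (OrderRegular.cat 𝒳) (OrderRegular.cat 𝒜))
    (G : DualFunctor (OrderRegular.cat 𝒜) (OrderRegular.cat 𝒳)) →
    IsDualEquivalence F G →
    PreservesExactSquares (OrderRegular.U 𝒳) (OrderRegular.U 𝒜) F →
    SurjectionsToEmbeddings (OrderRegular.U 𝒳) (OrderRegular.U 𝒜) F →
    PreservesExactSquares (OrderRegular.U 𝒜) (OrderRegular.U 𝒳) G →
    SurjectionsToEmbeddings (OrderRegular.U 𝒜) (OrderRegular.U 𝒳) G →
    RelExtensionEquivalence (OrderRegular.U 𝒳) (OrderRegular.U 𝒜) F G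
theorem7p6 𝒳 𝒜 F G eqv F-exact F-surj-emb G-exact G-surj-emb = record
  { F̄ = F̄.isRelExtension
  ; Ḡ = Ḡ.isRelExtension
  ; θ = θ.θ ; θ⁻¹ = θ.θ⁻¹ ; θ-rel = θ.θ-isCRel ; θ⁻¹-rel = θ.θ⁻¹-isCRel
  ; θ⁻¹θ = θ.θ⁻¹θ ; θθ⁻¹ = θ.θθ⁻¹ ; θ-natural = θ.θ-natural
  ; κ = κ.θ ; κ⁻¹ = κ.θ⁻¹ ; κ-rel = κ.θ-isCRel ; κ⁻¹-rel = κ.θ⁻¹-isCRel
  ; κ⁻¹κ = κ.θ⁻¹θ ; κκ⁻¹ = κ.θθ⁻¹ ; κ-natural = κ.θ-natural
  ; F̄-maps = F̄.H̄-maps-lower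
  ; Ḡ-maps = Ḡ.H̄-maps-upper
  }
  where
    module F̄ = Extension 𝒳 𝒜 F F-exact F-surj-emb
    module Ḡ = Extension 𝒜 𝒳 G G-exact G-surj-emb
    module θ = UnitIsomorphism 𝒳 𝒜 F G G-exact G-surj-emb eqv
    module κ = UnitIsomorphism 𝒜 𝒳 G F F-exact F-surj-emb (IsDualEquivalence-swap eqv)
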